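{- For every $n\ge 0$, the number of permutations in $S_n$ that avoid both the classical pattern $3\textrm{ - }1\textrm{ - }2$ and the consecutive pattern $321$ equals the $n$-th Motzkin number $M_n$.
   Context: A permutation $\sigma\in S_n$ avoids the classical pattern $3\textrm{ - }1\textrm{ - }2$ if there are no indices $i<j<l$ with $\sigma(j)<\sigma(l)<\sigma(i)$; it avoids the consecutive pattern $321$ if there is no index $i$ with $\sigma(i)>\sigma(i+1)>\sigma(i+2)$. The Motzkin number $M_n$ is the number of lattice paths from $(0,0)$ to $(n,0)$ with steps $(1,1)$, $(1,0)$, $(1,-1)$ that never go below the $x$-axis. -}

module Defs where

open import Data.Nat using (ℕ; zero; suc)
open import Data.Fin using (Fin; _<_)
open import Data.Fin.Properties using (any?; all?; _≟_; _<?_)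
open import Data.Vec using (Vec; []; _∷_; lookup)
open import Data.List using (List; []; _∷_; map; concatMap; length; filter; allFin)
open import Data.Product using (_×_; ∃-syntax)
open import Relation.Nullary using (¬_; Dec)
open import Relation.Nullary.Decidable using (¬?; _×-dec_; _→-dec_)
open import Relation.Binary.PropositionalEquality using (_≡_)
open import Data.Integer using (ℤ; +_; -[1+_]; _+_; _≤_)
open import Data.Integer.Properties using (_≤?_)

-- Permutations of {0,…,n-1} in one-line notation: σ is the vector
-- (σ(0), …, σ(n-1)) with entries in Fin n, required to be injective
-- (hence a bijection of the finite set Fin n).

words : (n k : ℕ) → List (Vec (Fin n) k)
words n zero = [] ∷ []
words n (suc k) = concatMap (λ w → map (_∷ w) (allFin n)) (words n k)

IsPerm : ∀ {n} → Vec (Fin n) n → Set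
IsPerm {n} σ = ∀ (i j : Fin n) → lookup σ i ≡ lookup σ j → i ≡ j

Contains312 : ∀ {n} → Vec (Fin n) n → Set
Contains312 {n} σ = ∃[ i ] ∃[ j ] ∃[ l ]
  (i < j × j < l × lookup σ j < lookup σ l × lookup σ l < lookup σ i)

Avoids312 : ∀ {n} → Vec (Fin n) n → Set
Avoids312 σ = ¬ Contains312 σ

open import Data.Fin using (toℕ)
Contains321c : ∀ {n} → Vec (Fin n) n → Set
Contains321c {n} σ = ∃[ i ] ∃[ j ] ∃[ l ]
  (toℕ j ≡ suc (toℕ i) × toℕ l ≡ suc (toℕ j)
   × lookup σ j < lookup σ i × lookup σ l < lookup σ j)

Avoids321c : ∀ {n} → Vec (Fin n) n → Set
Avoids321c σ = ¬ Contains321c σ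

import Data.Nat.Properties as ℕP

isPerm? : ∀ {n} (σ : Vec (Fin n) n) → Dec (IsPerm σ)
isPerm? σ = all? λ i → all? λ j → (lookup σ i ≟ lookup σ j) →-dec (i ≟ j)

contains312? : ∀ {n} (σ : Vec (Fin n) n) → Dec (Contains312 σ)
contains312? σ = any? λ i → any? λ j → any? λ l →
  (i <? j) ×-dec (j <? l) ×-dec (lookup σ j <? lookup σ l) ×-dec (lookup σ l <? lookup σ i)

contains321c? : ∀ {n} (σ : Vec (Fin n) n) → Dec (Contains321c σ)
contains321c? σ = any? λ i → any? λ j → any? λ l →
  (toℕ j ℕP.≟ suc (toℕ i)) ×-dec (toℕ l ℕP.≟ suc (toℕ j))
  ×-dec (lookup σ j <? lookup σ i) ×-dec (lookup σ l <? lookup σ j)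

Good : ∀ {n} → Vec (Fin n) n → Set
Good σ = IsPerm σ × Avoids312 σ × Avoids321c σ

good? : ∀ {n} (σ : Vec (Fin n) n) → Dec (Good σ)
good? σ = isPerm? σ ×-dec ¬? (contains312? σ) ×-dec ¬? (contains321c? σ)

numAvoiders : ℕ → ℕ
numAvoiders n = length (filter good? (words n n))

-- Motzkin paths: step sequences of length n (U = (1,1), H = (1,0),
-- D = (1,-1)) from height 0 back to height 0 never going below 0.

data Step : Set where
  U H D : Step

allSteps : List Step
allSteps = U ∷ H ∷ D ∷ []

stepVal : Step → ℤ
stepVal U = + 1
stepVal H = + 0
stepVal D = -[1+ 0 ]

stepWords : ℕ → List (List Step)
stepWords zero = [] ∷ []
stepWords (suc k) = concatMap (λ w → map (_∷ w) allSteps) (stepWords k)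

data PathOK : ℤ → List Step → Set where
  done : PathOK (+ 0) []
  step : ∀ {h} s {w} → + 0 ≤ h + stepVal s → PathOK (h + stepVal s) w → PathOK h (s ∷ w)

pathOK? : ∀ h w → Dec (PathOK h w)
pathOK? h [] with h Data.Integer.Properties.≟ + 0
... | Relation.Nullary.yes Relation.Binary.PropositionalEquality.refl = Relation.Nullary.yes done
... | Relation.Nullary.no ne = Relation.Nullary.no λ { done → ne Relation.Binary.PropositionalEquality.refl }
  where import Data.Integer.Properties
pathOK? h (s ∷ w) with (+ 0 ≤? h + stepVal s) | pathOK? (h + stepVal s) w
... | Relation.Nullary.yes p | Relation.Nullary.yes q = Relation.Nullary.yes (step s p q)
... | Relation.Nullary.no np | _ = Relation.Nullary.no λ { (step _ p _) → np p }
... | _ | Relation.Nullary.no nq = Relation.Nullary.no λ { (step _ _ q) → nq q }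

IsMotzkinPath : List Step → Set
IsMotzkinPath = PathOK (+ 0)

motzkin : ℕ → ℕ
motzkin n = length (filter (pathOK? (+ 0)) (stepWords n))

-- A Motzkin path is empty, H t, or U x D y for shorter paths x, y (first return to the axis).
-- An avoider σ splits the same way at the position of its value 0. If 0 comes first,
-- σ = 1 ⊕ σ′. Otherwise avoiding 3-1-2 (with the 0 as the "1") puts every entry before 0 below
-- every entry after it, and avoiding consecutive 321 makes the entry just before 0 exceed its
-- predecessor, hence (by 3-1-2 again) the whole prefix; so σ = ((τ ⊕ 1) ⊖ 1) ⊕ ρ for avoiders τ, ρ.
-- Conversely these constructions preserve avoidance, so both families are in bijection with
-- Motzkin trees.

module Submission where

open import Defs
open import Data.Nat using (ℕ; zero; suc; pred; _+_; _∸_; _<_; _≤_; _≤?_; s≤s; z≤n; z<s; s<s⁻¹; s≤s⁻¹)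
import Data.Nat.Properties as ℕ
open import Data.Nat.Induction using (<-rec)
open import Data.Integer as ℤ using (+≤+)
open import Data.Fin using (Fin; toℕ; fromℕ<)
import Data.Fin as Fin
open import Data.Fin.Properties using (toℕ-fromℕ<; toℕ-injective; toℕ<n; pigeonhole)
open import Data.Vec using (Vec; []; _∷_; lookup; tabulate)
open import Data.Vec.Properties using (lookup∘tabulate; tabulate∘lookup; tabulate-cong)
open import Data.List using (List; []; _∷_; map; concatMap; length; filter; allFin; _++_; cartesianProductWith)
open import Data.List.Properties using (length-map; length-++; ++-assoc; ++-identityʳ; ∷-injectiveʳ)
open import Data.List.Membership.Propositional using (_∈_; find)
open import Data.List.Membership.Propositional.Properties
open import Data.List.Membership.Propositional.Properties.WithK using (unique∧set⇒bag)
open import Data.List.Relation.Unary.Unique.Propositional using (Unique)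
import Data.List.Relation.Unary.Unique.Propositional.Properties as Unique
open import Data.List.Relation.Unary.Any as Any using (here; there)
import Data.List.Relation.Unary.All as All
open import Data.List.Relation.Unary.AllPairs using (_∷_; [])
open import Data.List.Relation.Binary.BagAndSetEquality using (∼bag⇒↭)
open import Data.List.Relation.Binary.Permutation.Propositional.Properties using (↭-length)
open import Data.Empty using (⊥; ⊥-elim)
open import Data.Product using (Σ; _×_; _,_; proj₁; proj₂)
open import Data.Sum using (_⊎_; inj₁; inj₂)
open import Function using (_∘_)
open import Function.Bundles using (mk⇔)
open import Relation.Nullary using (¬_; yes; no)
open import Relation.Binary.Definitions using (tri<; tri≈; tri>)
open import Relation.Binary.PropositionalEquality

private
  variable
    A B : Set

unique-same-members⇒length≡ : {xs ys : List A} → Unique xs → Unique ys →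
  (∀ {x} → x ∈ xs → x ∈ ys) → (∀ {x} → x ∈ ys → x ∈ xs) → length xs ≡ length ys
unique-same-members⇒length≡ uxs uys xs⊆ys ys⊆xs =
  ↭-length (∼bag⇒↭ (unique∧set⇒bag uxs uys (mk⇔ xs⊆ys ys⊆xs)))

-- The blocks f a are disjoint for distinct a because r recovers a from any element of f a.
Unique-concatMap⁺ : (f : A → List B) (r : B → A) → (∀ a {b} → b ∈ f a → r b ≡ a) →
  (∀ a → Unique (f a)) → ∀ {xs} → Unique xs → Unique (concatMap f xs)
Unique-concatMap⁺ f r r-inv uf {[]} _ = []
Unique-concatMap⁺ f r r-inv uf {x ∷ xs} (x∉xs ∷ uxs) =
  Unique.++⁺ (uf x) (Unique-concatMap⁺ f r r-inv uf uxs) disjoint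
  where
  disjoint : ∀ {b} → ¬ (b ∈ f x × b ∈ concatMap f xs)
  disjoint (b∈fx , b∈rest) with find (∈-concatMap⁻ f {xs = xs} b∈rest)
  ... | y , y∈xs , b∈fy = All.lookup x∉xs y∈xs (trans (sym (r-inv x b∈fx)) (r-inv y b∈fy))

prepend-each : ∀ {n k} → Vec (Fin n) k → List (Vec (Fin n) (suc k))
prepend-each {n} w = map (_∷ w) (allFin n)

words-unique : ∀ n k → Unique (words n k)
words-unique n zero = All.[] ∷ []
words-unique n (suc k) =
  Unique-concatMap⁺ prepend-each Data.Vec.tail tail-inv
    (λ w → Unique.map⁺ (λ { refl → refl }) (Unique.allFin⁺ n)) (words-unique n k)
  where
  tail-inv : ∀ w {v} → v ∈ prepend-each w → Data.Vec.tail v ≡ w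
  tail-inv w v∈ with _ , _ , refl ← ∈-map⁻ (_∷ w) v∈ = refl

∈-words : ∀ n k (v : Vec (Fin n) k) → v ∈ words n k
∈-words n zero [] = here refl
∈-words n (suc k) (x ∷ w) =
  ∈-concatMap⁺ prepend-each (Any.map (λ { refl → ∈-map⁺ (_∷ w) (∈-allFin x) }) (∈-words n k w))

prepend-steps : List Step → List (List Step)
prepend-steps w = map (_∷ w) allSteps

drop-step : List Step → List Step
drop-step [] = []
drop-step (_ ∷ w) = w

stepWords-unique : ∀ k → Unique (stepWords k)
stepWords-unique zero = All.[] ∷ []
stepWords-unique (suc k) =
  Unique-concatMap⁺ prepend-steps drop-step drop-inv (λ _ → distinct) (stepWords-unique k)
  where
  drop-inv : ∀ w {v} → v ∈ prepend-steps w → drop-step v ≡ w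
  drop-inv w v∈ with _ , _ , refl ← ∈-map⁻ (_∷ w) v∈ = refl
  distinct : ∀ {w} → Unique (prepend-steps w)
  distinct = ((λ ()) All.∷ (λ ()) All.∷ All.[]) ∷ ((λ ()) All.∷ All.[]) ∷ All.[] ∷ []

∈-allSteps : ∀ s → s ∈ allSteps
∈-allSteps U = here refl
∈-allSteps H = there (here refl)
∈-allSteps D = there (there (here refl))

∈-stepWords : (w : List Step) → w ∈ stepWords (length w)
∈-stepWords [] = here refl
∈-stepWords (s ∷ w) =
  ∈-concatMap⁺ prepend-steps (Any.map (λ { refl → ∈-map⁺ (_∷ w) (∈-allSteps s) }) (∈-stepWords w))

∈-stepWords⇒length : ∀ k {w} → w ∈ stepWords k → length w ≡ k
∈-stepWords⇒length zero (here refl) = refl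
∈-stepWords⇒length (suc k) w∈
  with w′ , w′∈ , w∈′ ← find (∈-concatMap⁻ prepend-steps {xs = stepWords k} w∈)
  with _ , _ , refl ← ∈-map⁻ (_∷ w′) w∈′ = cong suc (∈-stepWords⇒length k w′∈)

-- Motzkin trees

data MTree : ℕ → Set where
  leaf  : MTree 0
  level : ∀ {n} → MTree n → MTree (suc n)
  bump  : ∀ {m a b} → MTree a → MTree b → a + b ≡ m → MTree (suc (suc m))

Split : ℕ → Set
Split m = Σ ℕ λ a → Σ ℕ λ b → a + b ≡ m

split-suc : ∀ {m} → Split m → Split (suc m)
split-suc (a , b , a+b≡m) = suc a , b , cong suc a+b≡m

splits : (m : ℕ) → List (Split m)
splits zero = (0 , 0 , refl) ∷ []
splits (suc m) = (0 , suc m , refl) ∷ map split-suc (splits m)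

∈-splits : ∀ a b → (a , b , refl) ∈ splits (a + b)
∈-splits zero zero = here refl
∈-splits zero (suc b) = here refl
∈-splits (suc a) b = there (∈-map⁺ split-suc (∈-splits a b))

splits-unique : ∀ m → Unique (splits m)
splits-unique zero = All.[] ∷ []
splits-unique (suc m) = All.tabulate first-new ∷ Unique.map⁺ split-suc-injective (splits-unique m)
  where
  split-suc-injective : ∀ {s s′ : Split m} → split-suc s ≡ split-suc s′ → s ≡ s′
  split-suc-injective {a , b , e} {a′ , b′ , e′} eq
    with refl ← cong proj₁ eq | refl ← cong (proj₁ ∘ proj₂) eq
    = cong (λ e → a , b , e) (ℕ.≡-irrelevant e e′)
  first-new : ∀ {s} → s ∈ map split-suc (splits m) → (0 , suc m , refl) ≢ s
  first-new s∈ eq with _ , _ , refl ← ∈-map⁻ split-suc s∈ with () ← eq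

bumps : ∀ {m} → (∀ k → List (MTree k)) → Split m → List (MTree (suc (suc m)))
bumps T (a , b , e) = cartesianProductWith (λ x y → bump x y e) (T a) (T b)

-- The fuel only has to exceed the size; it makes the recursion structural.
trees′ : ℕ → (n : ℕ) → List (MTree n)
trees′ zero n = []
trees′ (suc fuel) zero = leaf ∷ []
trees′ (suc fuel) (suc zero) = map level (trees′ fuel 0)
trees′ (suc fuel) (suc (suc m)) = map level (trees′ fuel (suc m)) ++ concatMap (bumps (trees′ fuel)) (splits m)

trees : (n : ℕ) → List (MTree n)
trees n = trees′ (suc n) n

∈-trees′ : ∀ fuel {n} (t : MTree n) → n < fuel → t ∈ trees′ fuel n
∈-trees′ (suc fuel) leaf _ = here refl
∈-trees′ (suc fuel) (level {zero} t) (s≤s n<fuel) = ∈-map⁺ level (∈-trees′ fuel t n<fuel)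
∈-trees′ (suc fuel) (level {suc n} t) (s≤s n<fuel) = ∈-++⁺ˡ (∈-map⁺ level (∈-trees′ fuel t n<fuel))
∈-trees′ (suc fuel) (bump {a = a} {b} x y refl) (s≤s n<fuel) =
  ∈-++⁺ʳ _ (∈-concatMap⁺ (bumps (trees′ fuel))
    (Any.map (λ { refl → ∈-cartesianProductWith⁺ (λ x y → bump x y refl)
                           (∈-trees′ fuel x (ℕ.<-≤-trans (s≤s (ℕ.m≤m+n a b)) a+b<fuel))
                           (∈-trees′ fuel y (ℕ.<-≤-trans (s≤s (ℕ.m≤n+m b a)) a+b<fuel)) })
             (∈-splits a b)))
  where a+b<fuel = ℕ.<⇒≤ n<fuel

∈-trees : ∀ {n} (t : MTree n) → t ∈ trees n
∈-trees t = ∈-trees′ _ t ℕ.≤-refl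

split-of : ∀ {m} → MTree (suc (suc m)) → Split m
split-of {m} (level _) = 0 , m , refl
split-of (bump {a = a} {b} _ _ e) = a , b , e

trees′-unique : ∀ fuel n → Unique (trees′ fuel n)
trees′-unique zero n = []
trees′-unique (suc fuel) zero = All.[] ∷ []
trees′-unique (suc fuel) (suc zero) = Unique.map⁺ (λ { refl → refl }) (trees′-unique fuel 0)
trees′-unique (suc fuel) (suc (suc m)) =
  Unique.++⁺ (Unique.map⁺ (λ { refl → refl }) (trees′-unique fuel (suc m)))
             (Unique-concatMap⁺ (bumps (trees′ fuel)) split-of split-of-bumps bumps-unique (splits-unique m))
             level-not-bump
  where
  split-of-bumps : ∀ s {t} → t ∈ bumps (trees′ fuel) s → split-of t ≡ s
  split-of-bumps (a , b , e) t∈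
    with _ , _ , _ , _ , refl ← ∈-cartesianProductWith⁻ (λ x y → bump x y e) (trees′ fuel a) (trees′ fuel b)
                                   t∈
    = refl
  bumps-unique : ∀ s → Unique (bumps (trees′ fuel) s)
  bumps-unique (a , b , e) = Unique.cartesianProductWith⁺ (λ x y → bump x y e) (λ { refl → refl , refl })
                               (trees′-unique fuel a) (trees′-unique fuel b)
  level-not-bump : ∀ {t} →
    ¬ (t ∈ map level (trees′ fuel (suc m)) × t ∈ concatMap (bumps (trees′ fuel)) (splits m))
  level-not-bump (t∈levels , t∈bumps)
    with _ , _ , refl ← ∈-map⁻ level t∈levels
    with (a , b , e) , _ , t∈ ← find (∈-concatMap⁻ (bumps (trees′ fuel)) {xs = splits m} t∈bumps)
    with _ , _ , _ , _ , () ← ∈-cartesianProductWith⁻ (λ x y → bump x y e) (trees′ fuel a) (trees′ fuel b) t∈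

trees-unique : ∀ n → Unique (trees n)
trees-unique n = trees′-unique (suc n) n

-- Motzkin trees are Motzkin paths

path : ∀ {n} → MTree n → List Step
path leaf = []
path (level t) = H ∷ path t
path (bump x y _) = U ∷ path x ++ D ∷ path y

length-path : ∀ {n} (t : MTree n) → length (path t) ≡ n
length-path leaf = refl
length-path (level t) = cong suc (length-path t)
length-path (bump {a = a} {b} x y refl) = cong suc (begin
  length (path x ++ D ∷ path y)              ≡⟨ length-++ (path x) ⟩
  length (path x) + suc (length (path y))    ≡⟨ cong₂ (λ p q → p + suc q) (length-path x) (length-path y) ⟩
  a + suc b                                  ≡⟨ ℕ.+-suc a b ⟩
  suc (a + b)                                ∎)
  where open ≡-Reasoning

PathFrom : ℕ → List Step → Set
PathFrom h = PathOK (ℤ.+ h)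

H-valid : ∀ {h w} → PathFrom h w → PathFrom h (H ∷ w)
H-valid {h} {w} ok = step H (+≤+ z≤n) (subst (λ z → PathFrom z w) (sym (ℕ.+-identityʳ h)) ok)

U-valid : ∀ {h w} → PathFrom (suc h) w → PathFrom h (U ∷ w)
U-valid {h} {w} ok = step U (+≤+ z≤n) (subst (λ z → PathFrom z w) (ℕ.+-comm 1 h) ok)

D-valid : ∀ {h w} → PathFrom h w → PathFrom (suc h) (D ∷ w)
D-valid = step D (+≤+ z≤n)

path-valid : ∀ {n} h (t : MTree n) w → PathFrom h w → PathFrom h (path t ++ w)
path-valid h leaf w ok = ok
path-valid h (level t) w ok = H-valid (path-valid h t w ok)
path-valid h (bump x y _) w ok rewrite ++-assoc (path x) (D ∷ path y) w =
  U-valid (path-valid (suc h) x _ (D-valid (path-valid h y w ok)))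

-- A valid path from height h is t₀ D t₁ D … D t_h with every tᵢ a Motzkin tree.
Parse : ℕ → List Step → Set
Parse zero w = Σ ℕ λ k → Σ (MTree k) λ t → w ≡ path t
Parse (suc h) w = Σ ℕ λ k → Σ (MTree k) λ t → Σ (List Step) λ w′ → w ≡ path t ++ D ∷ w′ × Parse h w′

parse : ∀ h w → PathFrom h w → Parse h w
parse zero [] done = 0 , leaf , refl
parse zero (H ∷ w) (step _ _ ok)
  with _ , t , refl ← parse zero w (subst (λ z → PathFrom z w) (ℕ.+-identityʳ 0) ok)
  = _ , level t , refl
parse (suc h) (H ∷ w) (step _ _ ok)
  with _ , t , w′ , refl , p ← parse (suc h) w (subst (λ z → PathFrom z w) (ℕ.+-identityʳ (suc h)) ok)
  = _ , level t , w′ , refl , p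
parse zero (U ∷ w) (step _ _ ok)
  with _ , t , w′ , refl , (_ , t′ , refl) ← parse 1 w ok
  = _ , bump t t′ refl , refl
parse (suc h) (U ∷ w) (step _ _ ok)
  with _ , t , w′ , refl , (_ , t′ , w″ , refl , p)
         ← parse (suc (suc h)) w (subst (λ z → PathFrom z w) (ℕ.+-comm (suc h) 1) ok)
  = _ , bump t t′ refl , w″ , cong (U ∷_) (sym (++-assoc (path t) (D ∷ path t′) (D ∷ w″))) , p
parse zero (D ∷ w) (step _ () _)
parse (suc h) (D ∷ w) (step _ _ ok) = 0 , leaf , w , refl , parse h w ok

-- Reading past the first unmatched D recovers the tree in front of it.
path-D-injective : ∀ {k k′} (t : MTree k) (t′ : MTree k′) w w′ →
  path t ++ D ∷ w ≡ path t′ ++ D ∷ w′ → (_,_ {B = MTree} k t ≡ (k′ , t′)) × w ≡ w′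
path-D-injective leaf leaf w w′ refl = refl , refl
path-D-injective (level t) (level t′) w w′ eq
  with refl , refl ← path-D-injective t t′ w w′ (∷-injectiveʳ eq) = refl , refl
path-D-injective (bump x y e) (bump x′ y′ e′) w w′ eq
  with refl , eq′ ← path-D-injective x x′ (path y ++ D ∷ w) (path y′ ++ D ∷ w′)
                      (trans (sym (++-assoc (path x) _ _)) (trans (∷-injectiveʳ eq) (++-assoc (path x′) _ _)))
  with refl , refl ← path-D-injective y y′ w w′ eq′
  with refl ← e | refl ← e′ = refl , refl

path-injective : ∀ {n} {t t′ : MTree n} → path t ≡ path t′ → t ≡ t′
path-injective {t = t} {t′} eq with refl , _ ← path-D-injective t t′ [] [] (cong (_++ D ∷ []) eq) = refl

motzkin≡#trees : ∀ n → motzkin n ≡ length (trees n)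
motzkin≡#trees n = begin
  motzkin n                  ≡⟨ unique-same-members⇒length≡
                                  (Unique.filter⁺ (pathOK? (ℤ.+ 0)) (stepWords-unique n))
                                  (Unique.map⁺ path-injective (trees-unique n)) motzkin⊆paths paths⊆motzkin ⟩
  length (map path (trees n)) ≡⟨ length-map path (trees n) ⟩
  length (trees n)           ∎
  where
  open ≡-Reasoning
  paths⊆motzkin : ∀ {w} → w ∈ map path (trees n) → w ∈ filter (pathOK? (ℤ.+ 0)) (stepWords n)
  paths⊆motzkin w∈ with t , _ , refl ← ∈-map⁻ path w∈ =
    ∈-filter⁺ (pathOK? (ℤ.+ 0))
      (subst (λ k → path t ∈ stepWords k) (length-path t) (∈-stepWords (path t)))
      (subst IsMotzkinPath (++-identityʳ (path t)) (path-valid 0 t [] done))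
  motzkin⊆paths : ∀ {w} → w ∈ filter (pathOK? (ℤ.+ 0)) (stepWords n) → w ∈ map path (trees n)
  motzkin⊆paths w∈
    with w∈words , ok ← ∈-filter⁻ (pathOK? (ℤ.+ 0)) {xs = stepWords n} w∈
    with _ , t , refl ← parse 0 _ ok
    with refl ← trans (sym (length-path t)) (∈-stepWords⇒length n w∈words)
    = ∈-map⁺ path (∈-trees t)

-- A permutation of [0,n) is modelled by a function on ℕ whose values outside [0,n) are ignored;
-- this makes sums of permutations easy to define.
record IsAvoider (n : ℕ) (f : ℕ → ℕ) : Set where
  field
    injective : ∀ {i j} → i < n → j < n → f i ≡ f j → i ≡ j
    bounded   : ∀ {i} → i < n → f i < n
    avoids312 : ∀ {i j l} → i < j → j < l → l < n → f j < f l → f l < f i → ⊥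
    avoids321 : ∀ {i j l} → suc i ≡ j → suc j ≡ l → l < n → f j < f i → f l < f j → ⊥

_≗[_]_ : (ℕ → ℕ) → ℕ → (ℕ → ℕ) → Set
f ≗[ n ] g = ∀ {i} → i < n → f i ≡ g i

sym-≗ : ∀ {n f g} → f ≗[ n ] g → g ≗[ n ] f
sym-≗ f≗g i<n = sym (f≗g i<n)

<-pred : ∀ {i j n} → suc i ≡ j → j < n → i < n
<-pred refl = ℕ.<-trans (ℕ.n<1+n _)

IsAvoider-resp-≗ : ∀ {n f g} → f ≗[ n ] g → IsAvoider n f → IsAvoider n g
IsAvoider-resp-≗ {n} {f} {g} f≗g F = record
  { injective = λ i<n j<n gi≡gj → injective i<n j<n (trans (f≗g i<n) (trans gi≡gj (sym (f≗g j<n))))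
  ; bounded   = λ i<n → subst (_< n) (f≗g i<n) (bounded i<n)
  ; avoids312 = λ i<j j<l l<n → let j<n = ℕ.<-trans j<l l<n ; i<n = ℕ.<-trans i<j j<n in
      λ gj<gl gl<gi → avoids312 i<j j<l l<n (transport j<n l<n gj<gl) (transport l<n i<n gl<gi)
  ; avoids321 = λ i→j j→l l<n → let j<n = <-pred j→l l<n ; i<n = <-pred i→j j<n in
      λ gj<gi gl<gj → avoids321 i→j j→l l<n (transport j<n i<n gj<gi) (transport l<n j<n gl<gj)
  }
  where
  open IsAvoider F
  transport : ∀ {i j} → i < n → j < n → g i < g j → f i < f j
  transport i<n j<n = subst₂ _<_ (sym (f≗g i<n)) (sym (f≗g j<n))

-- Direct sums and skew sums

glue : ℕ → (ℕ → ℕ) → (ℕ → ℕ) → ℕ → ℕ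
glue zero f g i = g i
glue (suc k) f g zero = f 0
glue (suc k) f g (suc i) = glue k (f ∘ suc) g i

glue-left : ∀ k f g {i} → i < k → glue k f g i ≡ f i
glue-left (suc k) f g {zero} _ = refl
glue-left (suc k) f g {suc i} (s≤s i<k) = glue-left k (f ∘ suc) g i<k

glue-right : ∀ k f g j → glue k f g (k + j) ≡ g j
glue-right zero f g j = refl
glue-right (suc k) f g j = glue-right k (f ∘ suc) g j

glue-at : ∀ k f g → glue k f g k ≡ g 0
glue-at k f g = trans (cong (glue k f g) (sym (ℕ.+-identityʳ k))) (glue-right k f g 0)

data Side (k : ℕ) : ℕ → Set where
  left  : ∀ {i} → i < k → Side k i
  right : ∀ j → Side k (k + j)

side : ∀ k i → Side k i
side zero i = right i
side (suc k) zero = left z<s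
side (suc k) (suc i) with side k i
... | left i<k = left (s≤s i<k)
... | right j = right j

point : ℕ → ℕ
point _ = 0

_⊕⟨_⟩_ : (ℕ → ℕ) → ℕ → (ℕ → ℕ) → ℕ → ℕ
f ⊕⟨ a ⟩ g = glue a f (λ j → a + g j)

_⊖⟨_⟩1 : (ℕ → ℕ) → ℕ → ℕ → ℕ
f ⊖⟨ k ⟩1 = glue k (suc ∘ f) point

point-avoider : IsAvoider 1 point
point-avoider = record
  { injective = λ { z<s z<s _ → refl }
  ; bounded   = λ _ → z<s
  ; avoids312 = λ _ _ _ ()
  ; avoids321 = λ { refl refl (s≤s ()) } }

module _ {a b f g} (F : IsAvoider a f) (G : IsAvoider b g) where
  private
    module F = IsAvoider F
    module G = IsAvoider G
    h : ℕ → ℕ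
    h = f ⊕⟨ a ⟩ g

    h-left : ∀ {i} → i < a → h i ≡ f i
    h-left = glue-left a f _

    h-right : ∀ j → h (a + j) ≡ a + g j
    h-right = glue-right a f _

    cancel : ∀ {j} → a + j < a + b → j < b
    cancel = ℕ.+-cancelˡ-< a _ _

    low : ∀ {i} → i < a → h i < a
    low i<a = subst (_< a) (sym (h-left i<a)) (F.bounded i<a)

    high : ∀ j → a ≤ h (a + j)
    high j = subst (a ≤_) (sym (h-right j)) (ℕ.m≤m+n a (g j))

    left<right : ∀ {i} j → i < a → h i < h (a + j)
    left<right j i<a = ℕ.<-≤-trans (low i<a) (high j)

    right≮left : ∀ {i} j → i < a → h (a + j) < h i → ⊥
    right≮left j i<a hr<hl = ℕ.<-asym hr<hl (left<right j i<a)

    left<left : ∀ {i j} → i < a → j < a → h i < h j → f i < f j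
    left<left i<a j<a = subst₂ _<_ (h-left i<a) (h-left j<a)

    right<right : ∀ i j → h (a + i) < h (a + j) → g i < g j
    right<right i j hi<hj = ℕ.+-cancelˡ-< a _ _ (subst₂ _<_ (h-right i) (h-right j) hi<hj)

    suc-right : ∀ {i j} → suc (a + i) ≡ a + j → suc i ≡ j
    suc-right {i} eq = ℕ.+-cancelˡ-≡ a _ _ (trans (ℕ.+-suc a i) eq)

    injective : ∀ {i j} → i < a + b → j < a + b → h i ≡ h j → i ≡ j
    injective {i} {j} i<n j<n hi≡hj with side a i | side a j
    ... | left i<a | left j<a = F.injective i<a j<a (trans (sym (h-left i<a)) (trans hi≡hj (h-left j<a)))
    ... | left i<a | right j′ = ⊥-elim (ℕ.<⇒≢ (left<right j′ i<a) hi≡hj)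
    ... | right i′ | left j<a = ⊥-elim (ℕ.<⇒≢ (left<right i′ j<a) (sym hi≡hj))
    ... | right i′ | right j′ = cong (a +_) (G.injective (cancel i<n) (cancel j<n)
                                  (ℕ.+-cancelˡ-≡ a _ _ (trans (sym (h-right i′)) (trans hi≡hj (h-right j′)))))

    bounded : ∀ {i} → i < a + b → h i < a + b
    bounded {i} i<n with side a i
    ... | left i<a = ℕ.<-≤-trans (low i<a) (ℕ.m≤m+n a b)
    ... | right i′ = subst (_< a + b) (sym (h-right i′)) (ℕ.+-monoʳ-< a (G.bounded (cancel i<n)))

    avoids312 : ∀ {i j l} → i < j → j < l → l < a + b → h j < h l → h l < h i → ⊥
    avoids312 {i} {j} {l} i<j j<l l<n hj<hl hl<hi with side a l
    ... | left l<a = F.avoids312 i<j j<l l<a (left<left j<a l<a hj<hl) (left<left l<a i<a hl<hi)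
      where j<a = ℕ.<-trans j<l l<a
            i<a = ℕ.<-trans i<j j<a
    ... | right l′ with side a i
    ...   | left i<a = right≮left l′ i<a hl<hi
    ...   | right i′ with side a j
    ...     | left j<a = ℕ.<-asym i<j (ℕ.<-≤-trans j<a (ℕ.m≤m+n a i′))
    ...     | right j′ = G.avoids312 (ℕ.+-cancelˡ-< a _ _ i<j) (ℕ.+-cancelˡ-< a _ _ j<l) (cancel l<n)
                           (right<right j′ l′ hj<hl) (right<right l′ i′ hl<hi)

    avoids321 : ∀ {i j l} → suc i ≡ j → suc j ≡ l → l < a + b → h j < h i → h l < h j → ⊥
    avoids321 {i} {j} {l} i→j j→l l<n hj<hi hl<hj with side a l
    ... | left l<a = F.avoids321 i→j j→l l<a (left<left j<a i<a hj<hi) (left<left l<a j<a hl<hj)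
      where j<a = <-pred j→l l<a
            i<a = <-pred i→j j<a
    ... | right l′ with side a j
    ...   | left j<a = right≮left l′ j<a hl<hj
    ...   | right j′ with side a i
    ...     | left i<a = right≮left j′ i<a hj<hi
    ...     | right i′ = G.avoids321 (suc-right i→j) (suc-right j→l) (cancel l<n)
                           (right<right j′ i′ hj<hi) (right<right l′ j′ hl<hj)

  ⊕-avoider : IsAvoider (a + b) (f ⊕⟨ a ⟩ g)
  ⊕-avoider = record
    { injective = injective ; bounded = bounded ; avoids312 = avoids312 ; avoids321 = avoids321 }

NoFinalDescent : ℕ → (ℕ → ℕ) → Set
NoFinalDescent k f = ∀ {i j} → suc i ≡ j → suc j ≡ k → f j < f i → ⊥

beyond-last : ∀ k j → k + j < suc k → j ≡ 0
beyond-last k j k+j<1+k = ℕ.n<1⇒n≡0 (ℕ.+-cancelˡ-< k j 1 (subst (k + j <_) (ℕ.+-comm 1 k) k+j<1+k))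

-- Appending the new minimum can only create a 321 ending at it, from a final descent of f.
module _ {k f} (F : IsAvoider k f) (no-final-descent : NoFinalDescent k f) where
  private
    module F = IsAvoider F
    h : ℕ → ℕ
    h = f ⊖⟨ k ⟩1

    h-left : ∀ {i} → i < k → h i ≡ suc (f i)
    h-left = glue-left k (suc ∘ f) point

    h-right : ∀ j → h (k + j) ≡ 0
    h-right = glue-right k (suc ∘ f) point

    left<left : ∀ {i j} → i < k → j < k → h i < h j → f i < f j
    left<left i<k j<k hi<hj = s<s⁻¹ (subst₂ _<_ (h-left i<k) (h-left j<k) hi<hj)

    ≮right : ∀ {i} j → h i < h (k + j) → ⊥
    ≮right j hi<hr with () ← subst (_ <_) (h-right j) hi<hr

    injective : ∀ {i j} → i < suc k → j < suc k → h i ≡ h j → i ≡ j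
    injective {i} {j} i<n j<n hi≡hj with side k i | side k j
    ... | left i<k | left j<k =
          F.injective i<k j<k (ℕ.suc-injective (trans (sym (h-left i<k)) (trans hi≡hj (h-left j<k))))
    ... | left i<k | right j′ with () ← trans (sym (h-left i<k)) (trans hi≡hj (h-right j′))
    ... | right i′ | left j<k with () ← trans (sym (h-right i′)) (trans hi≡hj (h-left j<k))
    ... | right i′ | right j′ = cong (k +_) (trans (beyond-last k i′ i<n) (sym (beyond-last k j′ j<n)))

    bounded : ∀ {i} → i < suc k → h i < suc k
    bounded {i} i<n with side k i
    ... | left i<k = subst (_< suc k) (sym (h-left i<k)) (s≤s (F.bounded i<k))
    ... | right i′ = subst (_< suc k) (sym (h-right i′)) z<s

    avoids312 : ∀ {i j l} → i < j → j < l → l < suc k → h j < h l → h l < h i → ⊥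
    avoids312 {i} {j} {l} i<j j<l l<n hj<hl hl<hi with side k l
    ... | right l′ = ≮right l′ hj<hl
    ... | left l<k = F.avoids312 i<j j<l l<k (left<left j<k l<k hj<hl) (left<left l<k i<k hl<hi)
      where j<k = ℕ.<-trans j<l l<k
            i<k = ℕ.<-trans i<j j<k

    avoids321 : ∀ {i j l} → suc i ≡ j → suc j ≡ l → l < suc k → h j < h i → h l < h j → ⊥
    avoids321 {i} {j} {l} i→j j→l l<n hj<hi hl<hj with side k l
    ... | left l<k = F.avoids321 i→j j→l l<k (left<left j<k i<k hj<hi) (left<left l<k j<k hl<hj)
      where j<k = <-pred j→l l<k
            i<k = <-pred i→j j<k
    ... | right l′ with side k j
    ...   | right j′ = ≮right j′ hl<hj
    ...   | left j<k = no-final-descent i→j j→k (left<left j<k (<-pred i→j j<k) hj<hi)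
      where j→k = trans j→l (trans (cong (k +_) (beyond-last k l′ l<n)) (ℕ.+-identityʳ k))

  ⊖1-avoider : IsAvoider (suc k) (f ⊖⟨ k ⟩1)
  ⊖1-avoider = record
    { injective = injective ; bounded = bounded ; avoids312 = avoids312 ; avoids321 = avoids321 }

⊕point-noFinalDescent : ∀ {a f} → (∀ {i} → i < a → f i < a) → NoFinalDescent (suc a) (f ⊕⟨ a ⟩ point)
⊕point-noFinalDescent {a} {f} bounded {i} {j} i→j j→1+a hj<hi =
  ℕ.<-asym (bounded i<a) (subst₂ _<_ h-last (glue-left a f _ i<a) hj<hi)
  where
  j≡a : j ≡ a
  j≡a = ℕ.suc-injective j→1+a
  i<a : i < a
  i<a = subst (i <_) j≡a (subst (i <_) i→j (ℕ.n<1+n i))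
  h-last : (f ⊕⟨ a ⟩ point) j ≡ a
  h-last = trans (cong (f ⊕⟨ a ⟩ point) j≡a) (trans (glue-at a f _) (ℕ.+-identityʳ a))

-- A leaf has size 0, so its value is junk.
perm : ∀ {n} → MTree n → ℕ → ℕ
perm leaf = point
perm (level t) = point ⊕⟨ 1 ⟩ perm t
perm (bump {a = a} x y _) = ((perm x ⊕⟨ a ⟩ point) ⊖⟨ suc a ⟩1) ⊕⟨ suc (suc a) ⟩ perm y

perm-avoider : ∀ {n} (t : MTree n) → IsAvoider n (perm t)
perm-avoider leaf = record { injective = λ () ; bounded = λ () ; avoids312 = λ _ _ () ; avoids321 = λ _ _ () }
perm-avoider (level t) = ⊕-avoider point-avoider (perm-avoider t)
perm-avoider (bump {a = a} x y refl) = ⊕-avoider {suc (suc a)} x⊕1⊖1 (perm-avoider y)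
  where
  X : IsAvoider a (perm x)
  X = perm-avoider x
  x⊕1 : IsAvoider (suc a) (perm x ⊕⟨ a ⟩ point)
  x⊕1 = subst (λ k → IsAvoider k (perm x ⊕⟨ a ⟩ point)) (ℕ.+-comm a 1) (⊕-avoider X point-avoider)
  x⊕1⊖1 : IsAvoider (suc (suc a)) ((perm x ⊕⟨ a ⟩ point) ⊖⟨ suc a ⟩1)
  x⊕1⊖1 = ⊖1-avoider x⊕1 (⊕point-noFinalDescent (IsAvoider.bounded X))

module _ {a b m} (x : MTree a) (y : MTree b) (e : a + b ≡ m) where
  private
    a<2+a : a < suc (suc a)
    a<2+a = ℕ.<-trans (ℕ.n<1+n a) (ℕ.n<1+n (suc a))
    x⊕1 x⊕1⊖1 : ℕ → ℕ
    x⊕1 = perm x ⊕⟨ a ⟩ point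
    x⊕1⊖1 = x⊕1 ⊖⟨ suc a ⟩1

  perm-bump-left : ∀ {i} → i < a → perm (bump x y e) i ≡ suc (perm x i)
  perm-bump-left {i} i<a = begin
    perm (bump x y e) i  ≡⟨ glue-left (suc (suc a)) x⊕1⊖1 _ (ℕ.<-trans i<a a<2+a) ⟩
    x⊕1⊖1 i              ≡⟨ glue-left (suc a) (suc ∘ x⊕1) point (ℕ.<-trans i<a (ℕ.n<1+n a)) ⟩
    suc (x⊕1 i)          ≡⟨ cong suc (glue-left a (perm x) _ i<a) ⟩
    suc (perm x i)       ∎
    where open ≡-Reasoning

  perm-bump-peak : perm (bump x y e) a ≡ suc a
  perm-bump-peak = begin
    perm (bump x y e) a  ≡⟨ glue-left (suc (suc a)) x⊕1⊖1 _ a<2+a ⟩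
    x⊕1⊖1 a              ≡⟨ glue-left (suc a) (suc ∘ x⊕1) point (ℕ.n<1+n a) ⟩
    suc (x⊕1 a)          ≡⟨ cong suc (glue-at a (perm x) _) ⟩
    suc (a + 0)          ≡⟨ cong suc (ℕ.+-identityʳ a) ⟩
    suc a                ∎
    where open ≡-Reasoning

  perm-bump-valley : perm (bump x y e) (suc a) ≡ 0
  perm-bump-valley =
    trans (glue-left (suc (suc a)) x⊕1⊖1 _ (ℕ.n<1+n (suc a))) (glue-at (suc a) (suc ∘ x⊕1) point)

  perm-bump-right : ∀ j → perm (bump x y e) (suc (suc a) + j) ≡ suc (suc a) + perm y j
  perm-bump-right = glue-right (suc (suc a)) x⊕1⊖1 _

valley<n : ∀ {a b m} → a + b ≡ m → suc a < suc (suc m)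
valley<n {a} {b} refl = s≤s (s≤s (ℕ.m≤m+n a b))

-- The position of the value 0 determines the shape of the root, and then the subtrees.
perm-injective : ∀ {n} (t t′ : MTree n) → perm t ≗[ n ] perm t′ → t ≡ t′
perm-injective leaf leaf _ = refl
perm-injective (level t) (level t′) t≗t′ =
  cong level (perm-injective t t′ (λ i<n → ℕ.suc-injective (t≗t′ (s≤s i<n))))
perm-injective (level t) (bump x y e) t≗t′ with () ← t≗t′ z<s
perm-injective (bump x y e) (level t) t≗t′ with () ← t≗t′ z<s
perm-injective (bump {m} {a} {b} x y e) t′@(bump {a = a′} {b′} x′ y′ e′) t≗t′
  with refl ← IsAvoider.injective (perm-avoider t′) (valley<n {a} e) (valley<n {a′} e′)
                (trans (sym (t≗t′ (valley<n {a} e))) (trans (perm-bump-valley x y e) (sym (perm-bump-valley x′ y′ e′))))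
  with refl ← ℕ.+-cancelˡ-≡ a b b′ (trans e (sym e′))
  with refl ← ℕ.≡-irrelevant e e′
  = cong₂ (λ u v → bump u v e) (perm-injective x x′ x≗x′) (perm-injective y y′ y≗y′)
  where
  x≗x′ : perm x ≗[ a ] perm x′
  x≗x′ i<a = ℕ.suc-injective (trans (sym (perm-bump-left x y e i<a))
               (trans (t≗t′ (ℕ.<-trans i<a (ℕ.<-trans (ℕ.n<1+n a) (valley<n {a} e)))) (perm-bump-left x′ y′ e i<a)))
  y≗y′ : perm y ≗[ b ] perm y′
  y≗y′ {j} j<b = ℕ.+-cancelˡ-≡ (suc (suc a)) _ _ (trans (sym (perm-bump-right x y e j))
                   (trans (t≗t′ (s≤s (s≤s (subst (a + j <_) e (ℕ.+-monoʳ-< a j<b))))) (perm-bump-right x′ y′ e j)))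

-- Every avoider is the permutation of a Motzkin tree

minimiser : ∀ n (f : ℕ → ℕ) → Σ ℕ λ p → p < suc n × (∀ {i} → i < suc n → f p ≤ f i)
minimiser zero f = 0 , z<s , λ { z<s → ℕ.≤-refl }
minimiser (suc n) f with p , p<1+n , minimal ← minimiser n f | f p ≤? f (suc n)
... | yes fp≤ = p , ℕ.m<n⇒m<1+n p<1+n , λ i<2+n → case (ℕ.m<1+n⇒m<n∨m≡n i<2+n)
  where case : ∀ {i} → i < suc n ⊎ i ≡ suc n → f p ≤ f i
        case (inj₁ i<1+n) = minimal i<1+n
        case (inj₂ refl) = fp≤
... | no fp≰ = suc n , ℕ.n<1+n (suc n) , λ i<2+n → case (ℕ.m<1+n⇒m<n∨m≡n i<2+n)
  where case : ∀ {i} → i < suc n ⊎ i ≡ suc n → f (suc n) ≤ f i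
        case (inj₁ i<1+n) = ℕ.≤-trans (ℕ.<⇒≤ (ℕ.≰⇒> fp≰)) (minimal i<1+n)
        case (inj₂ refl) = ℕ.≤-refl

injective⇒≤ : ∀ n m (f : ℕ → ℕ) → (∀ {i} → i < n → f i < m) →
  (∀ {i j} → i < n → j < n → f i ≡ f j → i ≡ j) → n ≤ m
injective⇒≤ n m f bounded injective = ℕ.≮⇒≥ m≮n
  where
  m≮n : m < n → ⊥
  m≮n m<n with i , j , i<j , fi≡fj ← pigeonhole m<n (λ k → fromℕ< (bounded (toℕ<n k))) =
    ℕ.<⇒≢ i<j (injective (toℕ<n i) (toℕ<n j)
      (trans (sym (toℕ-fromℕ< _)) (trans (cong toℕ fi≡fj) (toℕ-fromℕ< _))))

∸-cancelʳ-< : ∀ {x y} c → x ∸ c < y ∸ c → x < y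
∸-cancelʳ-< {x} {y} c x∸c<y∸c = ℕ.≰⇒> (λ y≤x → ℕ.<⇒≱ x∸c<y∸c (ℕ.∸-monoˡ-≤ c y≤x))

window-avoider : ∀ {n f} → IsAvoider n f → ∀ s b c → s + b ≤ n →
  (∀ {i} → i < b → c ≤ f (s + i)) → (∀ {i} → i < b → f (s + i) ∸ c < b) →
  IsAvoider b (λ i → f (s + i) ∸ c)
window-avoider {n} {f} F s b c s+b≤n c≤ <b = record
  { injective = λ i<b j<b eq →
      ℕ.+-cancelˡ-≡ s _ _ (injective (at i<b) (at j<b) (ℕ.∸-cancelʳ-≡ (c≤ i<b) (c≤ j<b) eq))
  ; bounded   = <b
  ; avoids312 = λ i<j j<l l<b fj<fl fl<fi →
      avoids312 (ℕ.+-monoʳ-< s i<j) (ℕ.+-monoʳ-< s j<l) (at l<b) (∸-cancelʳ-< c fj<fl) (∸-cancelʳ-< c fl<fi)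
  ; avoids321 = λ { {i} {j} refl refl l<b fj<fi fl<fj →
      avoids321 (sym (ℕ.+-suc s i)) (sym (ℕ.+-suc s j)) (at l<b) (∸-cancelʳ-< c fj<fi) (∸-cancelʳ-< c fl<fj) }
  }
  where
  open IsAvoider F
  at : ∀ {i} → i < b → s + i < n
  at i<b = ℕ.<-≤-trans (ℕ.+-monoʳ-< s i<b) s+b≤n

level-≗ : ∀ {n f} (t : MTree n) → perm t ≗[ n ] (λ j → f (suc j) ∸ 1) →
  f 0 ≡ 0 → (∀ {j} → j < n → 1 ≤ f (suc j)) → perm (level t) ≗[ suc n ] f
level-≗ t t≗ f0≡0 positive {zero} _ = sym f0≡0
level-≗ t t≗ f0≡0 positive {suc j} (s≤s j<n) = trans (cong suc (t≗ j<n)) (ℕ.m+[n∸m]≡n (positive j<n))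

bump-≗ : ∀ {q b f} (x : MTree q) (y : MTree b) →
  perm x ≗[ q ] (λ i → f i ∸ 1) → perm y ≗[ b ] (λ j → f (suc (suc q) + j) ∸ suc (suc q)) →
  (∀ {i} → i < q → 1 ≤ f i) → f q ≡ suc q → f (suc q) ≡ 0 →
  (∀ {j} → j < b → suc (suc q) ≤ f (suc (suc q) + j)) →
  perm (bump x y refl) ≗[ suc (suc (q + b)) ] f
bump-≗ {q} {b} {f} x y x≗ y≗ positive peak valley large {i} i<N with side (suc (suc q)) i
... | right j = trans (perm-bump-right x y refl j) (trans (cong (suc (suc q) +_) (y≗ j<b)) (ℕ.m+[n∸m]≡n (large j<b)))
  where j<b = ℕ.+-cancelˡ-< (suc (suc q)) j b i<N
... | left i<2+q with ℕ.<-cmp i q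
...   | tri< i<q _ _ = trans (perm-bump-left x y refl i<q) (trans (cong suc (x≗ i<q)) (ℕ.m+[n∸m]≡n (positive i<q)))
...   | tri≈ _ refl _ = trans (perm-bump-peak x y refl) (sym peak)
...   | tri> _ _ q<i with refl ← ℕ.≤-antisym (s≤s⁻¹ i<2+q) q<i = trans (perm-bump-valley x y refl) (sym valley)

Decomposition : ℕ → (ℕ → ℕ) → Set
Decomposition n f = Σ (MTree n) λ t → perm t ≗[ n ] f

Decomposable : ℕ → Set
Decomposable n = ∀ {f} → IsAvoider n f → Decomposition n f

module _ {n f} (F : IsAvoider n f) where
  open IsAvoider F

  positive-elsewhere : ∀ {p i} → p < n → f p ≡ 0 → i < n → i ≢ p → 1 ≤ f i
  positive-elsewhere p<n fp≡0 i<n i≢p =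
    ℕ.n≢0⇒n>0 (λ fi≡0 → i≢p (injective i<n p<n (trans fi≡0 (sym fp≡0))))

  minimum-is-0 : ∀ {p} → p < n → (∀ {i} → i < n → f p ≤ f i) → f p ≡ 0
  minimum-is-0 {p} p<n minimal = ℕ.∸-cancelˡ-≡ (ℕ.<⇒≤ (bounded p<n)) z≤n
    (ℕ.≤-antisym (ℕ.m∸n≤m n (f p)) (injective⇒≤ n (n ∸ f p) (λ i → f i ∸ f p)
      (λ i<n → ℕ.∸-monoˡ-< (bounded i<n) (minimal i<n))
      (λ i<n j<n eq → injective i<n j<n (ℕ.∸-cancelʳ-≡ (minimal i<n) (minimal j<n) eq))))

module Valley {q b f} (F : IsAvoider (suc (suc (q + b))) f) (valley : f (suc q) ≡ 0) where
  open IsAvoider F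

  private
    N : ℕ
    N = suc (suc (q + b))

    1+q<N : suc q < N
    1+q<N = s≤s (s≤s (ℕ.m≤m+n q b))

    q<N : q < N
    q<N = ℕ.<-trans (ℕ.n<1+n q) 1+q<N

    <-by-exclusion : ∀ {i j} → i < N → j < N → i ≢ j → (f j < f i → ⊥) → f i < f j
    <-by-exclusion i<N j<N i≢j fj≮fi =
      ℕ.≤∧≢⇒< (ℕ.≮⇒≥ fj≮fi) (λ fi≡fj → i≢j (injective i<N j<N fi≡fj))

  positive : ∀ {i} → i < N → i ≢ suc q → 1 ≤ f i
  positive = positive-elsewhere F 1+q<N valley

  positive-before : ∀ {i} → i < suc q → 1 ≤ f i
  positive-before i<1+q = positive (ℕ.<-trans i<1+q 1+q<N) (ℕ.<⇒≢ i<1+q)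

  positive-prefix : ∀ {i} → i < q → 1 ≤ f i
  positive-prefix i<q = positive-before (ℕ.m<n⇒m<1+n i<q)

  before<after : ∀ {i l} → i < suc q → suc q < l → l < N → f i < f l
  before<after {i} {l} i<1+q 1+q<l l<N = <-by-exclusion (ℕ.<-trans i<1+q 1+q<N) l<N (ℕ.<⇒≢ (ℕ.<-trans i<1+q 1+q<l))
    (avoids312 i<1+q 1+q<l l<N (subst (_< f l) (sym valley) (positive l<N (ℕ.>⇒≢ 1+q<l))))

  ascent-into-valley : ∀ {r} → suc r ≡ q → f r < f q
  ascent-into-valley {r} r→q = <-by-exclusion (ℕ.<-trans r<q q<N) q<N (ℕ.<⇒≢ r<q)
    (λ fq<fr → avoids321 r→q refl 1+q<N fq<fr (subst (_< f q) (sym valley) (positive-before (ℕ.n<1+n q))))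
    where r<q = subst (r <_) r→q (ℕ.n<1+n r)

  peak-max : ∀ {i} → i < q → f i < f q
  peak-max {i} i<q with ℕ.m≤n⇒m<n∨m≡n i<q
  ... | inj₂ i→q = ascent-into-valley i→q
  ... | inj₁ 1+i<q = <-by-exclusion (ℕ.<-trans i<q q<N) q<N (ℕ.<⇒≢ i<q) fq≮fi
    where
    suc-pred : ∀ {m n} → m < n → suc (pred n) ≡ n
    suc-pred (s≤s _) = refl
    r→q : suc (pred q) ≡ q
    r→q = suc-pred i<q
    fq≮fi : f q < f i → ⊥
    fq≮fi = avoids312 (s≤s⁻¹ (subst (suc i <_) (sym r→q) 1+i<q)) (subst (pred q <_) r→q (ℕ.n<1+n _)) q<N
              (ascent-into-valley r→q)

  private
    suffix : ∀ {j} → j < b → suc (suc q) + j < N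
    suffix j<b = ℕ.+-monoʳ-< (suc (suc q)) j<b

  peak<suffix : ∀ {j} → j < b → f q < f (suc (suc q) + j)
  peak<suffix j<b = before<after (ℕ.n<1+n q) (s≤s (s≤s (ℕ.m≤m+n q _))) (suffix j<b)

  -- Pigeonhole twice: the q + 1 prefix values are distinct in [1, f q], and the b suffix values
  -- are distinct in (f q, N).
  peak-value : f q ≡ suc q
  peak-value = ℕ.≤-antisym peak≤ peak≥
    where
    prefix<peak : ∀ {i} → i < suc q → f i ∸ 1 < f q
    prefix<peak i<1+q with ℕ.m<1+n⇒m<n∨m≡n i<1+q
    ... | inj₁ i<q = ℕ.∸-monoˡ-< (s≤s (ℕ.<⇒≤ (peak-max i<q))) (positive-prefix i<q)
    ... | inj₂ refl = ℕ.∸-monoˡ-< (ℕ.n<1+n (f q)) (positive-before (ℕ.n<1+n q))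
    peak≥ : suc q ≤ f q
    peak≥ = injective⇒≤ (suc q) (f q) (λ i → f i ∸ 1) prefix<peak
      (λ i<1+q j<1+q eq → injective (ℕ.<-trans i<1+q 1+q<N) (ℕ.<-trans j<1+q 1+q<N)
        (ℕ.∸-cancelʳ-≡ (positive-before i<1+q) (positive-before j<1+q) eq))
    suffix-count : b ≤ N ∸ suc (f q)
    suffix-count = injective⇒≤ b (N ∸ suc (f q)) (λ j → f (suc (suc q) + j) ∸ suc (f q))
      (λ j<b → ℕ.∸-monoˡ-< (bounded (suffix j<b)) (peak<suffix j<b))
      (λ j<b k<b eq → ℕ.+-cancelˡ-≡ (suc (suc q)) _ _ (injective (suffix j<b) (suffix k<b)
        (ℕ.∸-cancelʳ-≡ (peak<suffix j<b) (peak<suffix k<b) eq)))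
    peak≤ : f q ≤ suc q
    peak≤ = ℕ.+-cancelʳ-≤ b (f q) (suc q) (begin
      f q + b                  ≤⟨ ℕ.+-monoʳ-≤ (f q) suffix-count ⟩
      f q + (suc (q + b) ∸ f q) ≡⟨ ℕ.m+[n∸m]≡n (s≤s⁻¹ (bounded q<N)) ⟩
      suc q + b                 ∎)
      where open ℕ.≤-Reasoning

  large-suffix : ∀ {j} → j < b → suc (suc q) ≤ f (suc (suc q) + j)
  large-suffix j<b = subst (_< f _) peak-value (peak<suffix j<b)

  prefix-avoider : IsAvoider q (λ i → f i ∸ 1)
  prefix-avoider = window-avoider F 0 q 1 (ℕ.<⇒≤ q<N) positive-prefix
    (λ i<q → ℕ.∸-monoˡ-< (subst (f _ <_) peak-value (peak-max i<q)) (positive-prefix i<q))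

  suffix-avoider : IsAvoider b (λ j → f (suc (suc q) + j) ∸ suc (suc q))
  suffix-avoider = window-avoider F (suc (suc q)) b (suc (suc q)) ℕ.≤-refl large-suffix
    (λ j<b → subst (_ <_) (ℕ.m+n∸m≡n (suc (suc q)) b) (ℕ.∸-monoˡ-< (bounded (suffix j<b)) (large-suffix j<b)))

  decompose-bump : Decomposable q → Decomposable b → Decomposition N f
  decompose-bump decompose-q decompose-b =
    let x , x≗ = decompose-q prefix-avoider
        y , y≗ = decompose-b suffix-avoider
    in bump x y refl , bump-≗ x y x≗ y≗ positive-prefix peak-value valley large-suffix

decompose-level : ∀ {n f} → IsAvoider (suc n) f → f 0 ≡ 0 → Decomposable n → Decomposition (suc n) f
decompose-level {n} {f} F f0≡0 decompose-n =
  let t , t≗ = decompose-n (window-avoider F 1 n 1 ℕ.≤-refl positive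
                 (λ j<n → ℕ.∸-monoˡ-< (IsAvoider.bounded F (s≤s j<n)) (positive j<n)))
  in level t , level-≗ {f = f} t t≗ f0≡0 positive
  where
  positive : ∀ {j} → j < n → 1 ≤ f (suc j)
  positive j<n = positive-elsewhere F z<s f0≡0 (s≤s j<n) (λ ())

decompose : ∀ n → Decomposable n
decompose = <-rec Decomposable split-at-0
  where
  split-at-0 : ∀ n → (∀ {m} → m < n → Decomposable m) → Decomposable n
  split-at-0 zero _ _ = leaf , λ ()
  split-at-0 (suc n) rec {f} F with minimiser n f
  ... | zero , 0<1+n , minimal = decompose-level F (minimum-is-0 F 0<1+n minimal) (rec (ℕ.n<1+n n))
  ... | suc q , p<1+n , minimal with b , refl ← ℕ.m≤n⇒∃[o]m+o≡n p<1+n =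
    Valley.decompose-bump F (minimum-is-0 F p<1+n minimal)
      (rec (s≤s (ℕ.m≤n⇒m≤1+n (ℕ.m≤m+n q b)))) (rec (s≤s (ℕ.m≤n⇒m≤1+n (ℕ.m≤n+m b q))))

-- The value outside [0,n) is junk.
fun : ∀ {m n} → Vec (Fin m) n → ℕ → ℕ
fun [] i = 0
fun (x ∷ v) zero = toℕ x
fun (x ∷ v) (suc i) = fun v i

fun-lookup : ∀ {m n} (v : Vec (Fin m) n) (k : Fin n) → fun v (toℕ k) ≡ toℕ (lookup v k)
fun-lookup (x ∷ v) Fin.zero = refl
fun-lookup (x ∷ v) (Fin.suc k) = fun-lookup v k

fun-fromℕ< : ∀ {m n} (v : Vec (Fin m) n) {i} (i<n : i < n) → fun v i ≡ toℕ (lookup v (fromℕ< i<n))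
fun-fromℕ< v i<n = trans (cong (fun v) (sym (toℕ-fromℕ< i<n))) (fun-lookup v (fromℕ< i<n))

fun-injective : ∀ {m n} (σ τ : Vec (Fin m) n) → fun σ ≗[ n ] fun τ → σ ≡ τ
fun-injective σ τ σ≗τ = begin
  σ                      ≡⟨ tabulate∘lookup σ ⟨
  tabulate (lookup σ)    ≡⟨ tabulate-cong (λ k → toℕ-injective
                              (trans (sym (fun-lookup σ k)) (trans (σ≗τ (toℕ<n k)) (fun-lookup τ k)))) ⟩
  tabulate (lookup τ)    ≡⟨ tabulate∘lookup τ ⟩
  τ                      ∎
  where open ≡-Reasoning

Good⇒IsAvoider : ∀ {n} (σ : Vec (Fin n) n) → Good σ → IsAvoider n (fun σ)
Good⇒IsAvoider {n} σ (σ-injective , σ-avoids312 , σ-avoids321) = record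
  { injective = λ i<n j<n eq → trans (sym (toℕ-fromℕ< i<n)) (trans (cong toℕ (σ-injective _ _
      (toℕ-injective (trans (sym (fun-fromℕ< σ i<n)) (trans eq (fun-fromℕ< σ j<n)))))) (toℕ-fromℕ< j<n))
  ; bounded   = λ i<n → subst (_< n) (sym (fun-fromℕ< σ i<n)) (toℕ<n _)
  ; avoids312 = λ {i} {j} {l} i<j j<l l<n σj<σl σl<σi →
      let j<n = ℕ.<-trans j<l l<n ; i<n = ℕ.<-trans i<j j<n in
      σ-avoids312 (fromℕ< i<n , fromℕ< j<n , fromℕ< l<n ,
        position< i<n j<n i<j , position< j<n l<n j<l , value< j<n l<n σj<σl , value< l<n i<n σl<σi)
  ; avoids321 = λ { {i} refl refl l<n σj<σi σl<σj →
      let j<n = <-pred refl l<n ; i<n = <-pred refl j<n in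
      σ-avoids321 (fromℕ< i<n , fromℕ< j<n , fromℕ< l<n ,
        trans (toℕ-fromℕ< j<n) (cong suc (sym (toℕ-fromℕ< i<n))) ,
        trans (toℕ-fromℕ< l<n) (cong suc (sym (toℕ-fromℕ< j<n))) ,
        value< j<n i<n σj<σi , value< l<n j<n σl<σj) }
  }
  where
  position< : ∀ {i j} (i<n : i < n) (j<n : j < n) → i < j → fromℕ< i<n Fin.< fromℕ< j<n
  position< i<n j<n = subst₂ _<_ (sym (toℕ-fromℕ< i<n)) (sym (toℕ-fromℕ< j<n))
  value< : ∀ {i j} (i<n : i < n) (j<n : j < n) →
    fun σ i < fun σ j → lookup σ (fromℕ< i<n) Fin.< lookup σ (fromℕ< j<n)
  value< i<n j<n = subst₂ _<_ (fun-fromℕ< σ i<n) (fun-fromℕ< σ j<n)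

IsAvoider⇒Good : ∀ {n} (σ : Vec (Fin n) n) → IsAvoider n (fun σ) → Good σ
IsAvoider⇒Good {n} σ A = σ-injective , σ-avoids312 , σ-avoids321
  where
  open IsAvoider A
  value< : ∀ {k l} → lookup σ k Fin.< lookup σ l → fun σ (toℕ k) < fun σ (toℕ l)
  value< {k} {l} = subst₂ _<_ (sym (fun-lookup σ k)) (sym (fun-lookup σ l))
  σ-injective : IsPerm σ
  σ-injective k l eq = toℕ-injective (injective (toℕ<n k) (toℕ<n l)
    (trans (fun-lookup σ k) (trans (cong toℕ eq) (sym (fun-lookup σ l)))))
  σ-avoids312 : Avoids312 σ
  σ-avoids312 (i , j , l , i<j , j<l , σj<σl , σl<σi) = avoids312 i<j j<l (toℕ<n l) (value< σj<σl) (value< σl<σi)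
  σ-avoids321 : Avoids321c σ
  σ-avoids321 (i , j , l , i→j , j→l , σj<σi , σl<σj) =
    avoids321 (sym i→j) (sym j→l) (toℕ<n l) (value< σj<σi) (value< σl<σj)

tree-vec : ∀ {n} → MTree n → Vec (Fin n) n
tree-vec t = tabulate (λ k → fromℕ< (IsAvoider.bounded (perm-avoider t) (toℕ<n k)))

fun-tree-vec : ∀ {n} (t : MTree n) → fun (tree-vec t) ≗[ n ] perm t
fun-tree-vec t i<n = trans (fun-fromℕ< (tree-vec t) i<n) (trans (cong toℕ (lookup∘tabulate _ (fromℕ< i<n)))
  (trans (toℕ-fromℕ< _) (cong (perm t) (toℕ-fromℕ< i<n))))

tree-vec-good : ∀ {n} (t : MTree n) → Good (tree-vec t)
tree-vec-good t = IsAvoider⇒Good (tree-vec t) (IsAvoider-resp-≗ (sym-≗ (fun-tree-vec t)) (perm-avoider t))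

tree-vec-injective : ∀ {n} {t t′ : MTree n} → tree-vec t ≡ tree-vec t′ → t ≡ t′
tree-vec-injective {t = t} {t′} eq = perm-injective t t′ λ i<n →
  trans (sym (fun-tree-vec t i<n)) (trans (cong (λ v → fun v _) eq) (fun-tree-vec t′ i<n))

tree-vec-surjective : ∀ {n} (σ : Vec (Fin n) n) → Good σ → Σ (MTree n) λ t → tree-vec t ≡ σ
tree-vec-surjective {n} σ good =
  let t , t≗σ = decompose n (Good⇒IsAvoider σ good)
  in t , fun-injective (tree-vec t) σ (λ i<n → trans (fun-tree-vec t i<n) (t≗σ i<n))

numAvoiders≡#trees : ∀ n → numAvoiders n ≡ length (trees n)
numAvoiders≡#trees n = begin
  numAvoiders n                   ≡⟨ unique-same-members⇒length≡
                                       (Unique.filter⁺ good? (words-unique n n))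
                                       (Unique.map⁺ tree-vec-injective (trees-unique n)) good⊆trees trees⊆good ⟩
  length (map tree-vec (trees n)) ≡⟨ length-map tree-vec (trees n) ⟩
  length (trees n)                ∎
  where
  open ≡-Reasoning
  trees⊆good : ∀ {σ} → σ ∈ map tree-vec (trees n) → σ ∈ filter good? (words n n)
  trees⊆good σ∈ with t , _ , refl ← ∈-map⁻ tree-vec σ∈ =
    ∈-filter⁺ good? (∈-words n n (tree-vec t)) (tree-vec-good t)
  good⊆trees : ∀ {σ} → σ ∈ filter good? (words n n) → σ ∈ map tree-vec (trees n)
  good⊆trees {σ} σ∈ with t , refl ← tree-vec-surjective σ (proj₂ (∈-filter⁻ good? {xs = words n n} σ∈)) =
    ∈-map⁺ tree-vec (∈-trees t)

proposition4 : (n : ℕ) → numAvoiders n ≡ motzkin n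
proposition4 n = begin
  numAvoiders n     ≡⟨ numAvoiders≡#trees n ⟩
  length (trees n)  ≡⟨ motzkin≡#trees n ⟨
  motzkin n         ∎
  where open ≡-Reasoning
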